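{- Let $G$ be a directed graph with root $r$ and terminal set $T$, and let $H\subseteq G$ be a rooted $\ell$-connected subgraph having $\nu$ cores. Let $E'\subseteq E(G)\setminus E(H)$ be a set of edges that covers at least a $\gamma$ fraction of the Halo-families of $H$ (i.e., covers $\mathsf{Halo}(C)$ for at least $\gamma\nu$ cores $C$ of $H$). Then the number of cores in $H\cup E'$ is at most $(1-\gamma/2)\nu$.
   Context: $H$ is rooted $\ell$-connected if it contains $\ell$ edge-disjoint $r\to t$ paths for every $t\in T\subseteq V\setminus\{r\}$. For a graph $H'$ containing $H$, a deficient set of $H'$ is $U\subseteq V$ with $r\notin U$, $U\cap T\neq\emptyset$ and $\deg^{in}_{H'}(U)\le\ell$ (i.e., $<\ell+1$; for $H'=H$ this means $=\ell$), where $\deg^{in}_{H'}(U)$ is the number of edges of $H'$ entering $U$. A core of $H'$ is a deficient set of $H'$ properly containing no other deficient set of $H'$; for a core $C$, $\mathsf{Halo}(C)$ is the family of deficient sets of $H'$ containing $C$ and no other core. An edge set $E'$ covers a deficient set $U$ of $H$ if $\deg^{in}_{H\cup E'}(U)\ge\ell+1$, and covers $\mathsf{Halo}(C)$ if it covers every member of it.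
   Formalization: The fraction γ of Halo-families covered by E' is taken to be a rational number. -}

module Defs where

open import Data.Nat using (ℕ; suc; _≤_)
open import Data.Fin using (Fin)
open import Data.Fin.Subset using (Subset; _∈_; _∉_; _⊆_; _⊂_; _∩_; _∪_; ∣_∣; Nonempty)
open import Data.Bool using (_∧_; not)
open import Data.Vec using (tabulate; lookup)
open import Data.List using (List; []; _∷_; map)
import Data.List.Membership.Propositional as L
open import Data.List.Relation.Unary.Unique.Propositional using (Unique)
open import Data.Product using (_×_; ∃)
open import Relation.Binary.PropositionalEquality using (_≡_; _≢_)
open import Relation.Nullary using (¬_)
open import Data.Empty using (⊥)

-- A directed multigraph G on vertex set Fin n with m edges, indexed by Fin m.
-- Edge e goes from tl e to hd e. Subgraphs (on the same vertex set) are
-- edge subsets  Subset m.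
record Digraph (n m : ℕ) : Set where
  field
    tl : Fin m → Fin n
    hd : Fin m → Fin n
open Digraph public

module _ {n m : ℕ} (G : Digraph n m) where

  entering : Subset m → Subset n → Subset m
  entering H' U = tabulate λ e → lookup H' e ∧ (not (lookup U (tl G e)) ∧ lookup U (hd G e))

  degIn : Subset m → Subset n → ℕ
  degIn H' U = ∣ entering H' U ∣

  data Walk (H' : Subset m) : Fin n → Fin n → List (Fin m) → Set where
    nil  : ∀ {v} → Walk H' v v []
    cons : ∀ {e w es} → e ∈ H' → Walk H' (hd G e) w es → Walk H' (tl G e) w (e ∷ es)

  Path : Subset m → Fin n → Fin n → List (Fin m) → Set
  Path H' s t es = Walk H' s t es × Unique (s ∷ map (hd G) es)

  module _ (r : Fin n) (T : Subset n) (ℓ : ℕ) where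

    RootedConnected : Subset m → Set
    RootedConnected H' = ∀ t → t ∈ T →
      ∃ λ (P : Fin ℓ → List (Fin m)) →
        (∀ i → Path H' r t (P i)) ×
        (∀ i j → i ≢ j → ∀ e → e L.∈ P i → e L.∈ P j → ⊥)

    Deficient : Subset m → Subset n → Set
    Deficient H' U = r ∉ U × Nonempty (U ∩ T) × degIn H' U ≤ ℓ

    Core : Subset m → Subset n → Set
    Core H' C = Deficient H' C × (∀ W → W ⊂ C → ¬ Deficient H' W)

    InHalo : Subset m → Subset n → Subset n → Set
    InHalo H' C U = Deficient H' U × C ⊆ U × (∀ C' → Core H' C' → C' ⊆ U → C' ≡ C)

    Covers : Subset m → Subset m → Subset n → Set
    Covers H E' U = suc ℓ ≤ degIn (H ∪ E') U

    CoversHalo : Subset m → Subset m → Subset n → Set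
    CoversHalo H E' C = ∀ U → InHalo H C U → Covers H E' U

-- xs is a duplicate-free list enumerating exactly the elements satisfying P
-- (so  length xs  is the number of such elements)
Enumerates : {A : Set} → (A → Set) → List A → Set
Enumerates {A} P xs = Unique xs × (∀ x → (x L.∈ xs → P x) × (P x → x L.∈ xs))

module Submission where

-- In a rooted ℓ-connected graph every deficient set has in-degree exactly ℓ, so submodularity of
-- the in-degree makes deficient sets sharing a terminal closed under intersection, and two cores
-- sharing a terminal coincide. H ∪ E′ is again rooted ℓ-connected, so each core of H lies in at
-- most one core of H ∪ E′, while every core C′ of H ∪ E′ contains a core of H. If C′ contains only
-- one core C of H, then C′ ∈ Halo(C), so Halo(C) is not covered. Let each core of H ∪ E′ collect
-- 2 units from the cores of H inside it, an uncovered core paying 2 and a covered one 1: then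
-- 2ν′ ≤ 2ν − #covered ≤ (2 − γ)ν.

module Subsets where

  open import Data.Nat using (suc; _+_; _≤_)
  open import Data.Nat.Properties using (+-suc; +-mono-≤; module ≤-Reasoning)
  open import Data.Fin using (Fin; zero; suc)
  open import Data.Fin.Properties using (injective⇒≤; suc-injective)
  open import Data.Fin.Subset
  open import Data.Vec using ([]; _∷_; here; there)
  open import Data.Fin.Subset.Properties using (p⊆q⇒∣p∣≤∣q∣; anySubset?; _⊂?_; ⊆-refl; ⊆-trans)
  open import Data.Fin.Subset.Induction using (⊂-wellFounded)
  open import Data.Product using (_×_; _,_; ∃)
  open import Function.Definitions using (Injective)
  open import Induction.WellFounded using (Acc; acc)
  open import Relation.Nullary using (¬_; yes; no)
  open import Relation.Nullary.Decidable using (_×-dec_)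
  open import Relation.Unary using (Pred; Decidable)
  open import Relation.Binary.PropositionalEquality using (_≡_; refl; cong; trans; sym)

  ∣p∩q∣+∣p∪q∣≡∣p∣+∣q∣ : ∀ {k} (p q : Subset k) → ∣ p ∩ q ∣ + ∣ p ∪ q ∣ ≡ ∣ p ∣ + ∣ q ∣
  ∣p∩q∣+∣p∪q∣≡∣p∣+∣q∣ []            []            = refl
  ∣p∩q∣+∣p∪q∣≡∣p∣+∣q∣ (outside ∷ p) (outside ∷ q) = ∣p∩q∣+∣p∪q∣≡∣p∣+∣q∣ p q
  ∣p∩q∣+∣p∪q∣≡∣p∣+∣q∣ (inside ∷ p)  (outside ∷ q) =
    trans (+-suc ∣ p ∩ q ∣ ∣ p ∪ q ∣) (cong suc (∣p∩q∣+∣p∪q∣≡∣p∣+∣q∣ p q))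
  ∣p∩q∣+∣p∪q∣≡∣p∣+∣q∣ (outside ∷ p) (inside ∷ q) =
    trans (+-suc ∣ p ∩ q ∣ ∣ p ∪ q ∣)
      (trans (cong suc (∣p∩q∣+∣p∪q∣≡∣p∣+∣q∣ p q)) (sym (+-suc ∣ p ∣ ∣ q ∣)))
  ∣p∩q∣+∣p∪q∣≡∣p∣+∣q∣ (inside ∷ p)  (inside ∷ q) =
    cong suc (trans (+-suc ∣ p ∩ q ∣ ∣ p ∪ q ∣)
      (trans (cong suc (∣p∩q∣+∣p∪q∣≡∣p∣+∣q∣ p q)) (sym (+-suc ∣ p ∣ ∣ q ∣))))

  ∣p∣+∣q∣≤∣r∣+∣s∣ : ∀ {k} {p q r s : Subset k} → p ∩ q ⊆ r ∩ s → p ∪ q ⊆ r ∪ s →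
                    ∣ p ∣ + ∣ q ∣ ≤ ∣ r ∣ + ∣ s ∣
  ∣p∣+∣q∣≤∣r∣+∣s∣ {p = p} {q} {r} {s} ∩⊆ ∪⊆ = begin
    ∣ p ∣ + ∣ q ∣             ≡⟨ ∣p∩q∣+∣p∪q∣≡∣p∣+∣q∣ p q ⟨
    ∣ p ∩ q ∣ + ∣ p ∪ q ∣     ≤⟨ +-mono-≤ (p⊆q⇒∣p∣≤∣q∣ ∩⊆) (p⊆q⇒∣p∣≤∣q∣ ∪⊆) ⟩
    ∣ r ∩ s ∣ + ∣ r ∪ s ∣     ≡⟨ ∣p∩q∣+∣p∪q∣≡∣p∣+∣q∣ r s ⟩
    ∣ r ∣ + ∣ s ∣             ∎
    where open ≤-Reasoning

  index : ∀ {k} (p : Subset k) {x} → x ∈ p → Fin ∣ p ∣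
  index (inside ∷ p)  here        = zero
  index (inside ∷ p)  (there x∈p) = suc (index p x∈p)
  index (outside ∷ p) (there x∈p) = index p x∈p

  index-injective : ∀ {k} (p : Subset k) {x y} (x∈p : x ∈ p) (y∈p : y ∈ p) →
                    index p x∈p ≡ index p y∈p → x ≡ y
  index-injective (inside ∷ p)  here        here        _  = refl
  index-injective (inside ∷ p)  (there x∈p) (there y∈p) eq =
    cong suc (index-injective p x∈p y∈p (suc-injective eq))
  index-injective (outside ∷ p) (there x∈p) (there y∈p) eq =
    cong suc (index-injective p x∈p y∈p eq)

  injective⇒≤∣p∣ : ∀ {j k} {p : Subset k} {f : Fin j → Fin k} →
                   Injective _≡_ _≡_ f → (∀ i → f i ∈ p) → j ≤ ∣ p ∣
  injective⇒≤∣p∣ {p = p} inj f∈p =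
    injective⇒≤ (λ eq → inj (index-injective p (f∈p _) (f∈p _) eq))

  Minimal : ∀ {k ℓ} → Pred (Subset k) ℓ → Pred (Subset k) ℓ
  Minimal P C = P C × (∀ W → W ⊂ C → ¬ P W)

  ⊆-minimal : ∀ {k ℓ} {P : Pred (Subset k) ℓ} → Decidable P →
              ∀ {U} → P U → ∃ λ C → Minimal P C × C ⊆ U
  ⊆-minimal {P = P} P? {U} = go (⊂-wellFounded U)
    where
    go : ∀ {U} → Acc _⊂_ U → P U → ∃ λ C → Minimal P C × C ⊆ U
    go {U} (acc smaller) PU with anySubset? (λ W → (W ⊂? U) ×-dec P? W)
    ... | yes (W , W⊂U@(W⊆U , _) , PW) =
      let C , minC , C⊆W = go (smaller W⊂U) PW in C , minC , ⊆-trans C⊆W W⊆U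
    ... | no ∄W = U , (PU , λ W W⊂U PW → ∄W (W , W⊂U , PW)) , ⊆-refl

module ListSums where

  open import Data.Nat using (ℕ; _+_; _*_; _≤_; z≤n)
  open import Data.Nat.Properties
    using (+-mono-≤; ≤-refl; ≤-trans; ≤-reflexive; m≤m+n; m≤n+m; +-comm; +-identityʳ)
    using (+-commutativeSemigroup)
  open import Algebra.Properties.CommutativeSemigroup +-commutativeSemigroup using (interchange)
  open import Data.List using (List; []; _∷_; length)
  open import Data.List.Membership.Propositional using (_∈_)
  open import Data.List.Relation.Unary.All as All using (All)
  open import Data.List.Relation.Unary.AllPairs using (_∷_)
  open import Data.List.Relation.Unary.Any using (here; there)
  open import Data.List.Relation.Unary.Unique.Propositional using (Unique)
  open import Data.Empty using (⊥-elim)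
  open import Relation.Nullary using (Dec; yes; no; ¬_)
  open import Function using (_∘_)
  open import Relation.Binary.PropositionalEquality using (_≡_; _≢_; refl; cong; cong₂; sym; trans; subst)

  ∑ : {A : Set} → List A → (A → ℕ) → ℕ
  ∑ []       f = 0
  ∑ (x ∷ xs) f = f x + ∑ xs f

  syntax ∑ xs (λ x → e) = ∑[ x ∈ xs ] e

  when : {P : Set} → Dec P → ℕ → ℕ
  when (yes _) n = n
  when (no _)  n = 0

  when-yes : ∀ {P : Set} (d : Dec P) {n} → P → when d n ≡ n
  when-yes (yes _) _  = refl
  when-yes (no ¬p) p = ⊥-elim (¬p p)

  when-no : ∀ {P : Set} (d : Dec P) {n} → ¬ P → when d n ≡ 0
  when-no (yes p) ¬p = ⊥-elim (¬p p)
  when-no (no _)  _  = refl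

  module _ {A : Set} where

    ∑-const : ∀ (xs : List A) c → ∑[ _ ∈ xs ] c ≡ length xs * c
    ∑-const []       c = refl
    ∑-const (x ∷ xs) c = cong (c +_) (∑-const xs c)

    ∑-mono : ∀ {f g : A → ℕ} xs → (∀ {x} → x ∈ xs → f x ≤ g x) → ∑ xs f ≤ ∑ xs g
    ∑-mono []       f≤g = z≤n
    ∑-mono (x ∷ xs) f≤g = +-mono-≤ (f≤g (here refl)) (∑-mono xs (f≤g ∘ there))

    ∑-zero : ∀ {f : A → ℕ} xs → (∀ {x} → x ∈ xs → f x ≡ 0) → ∑ xs f ≡ 0
    ∑-zero []       f≡0 = refl
    ∑-zero (x ∷ xs) f≡0 = cong₂ _+_ (f≡0 (here refl)) (∑-zero xs (f≡0 ∘ there))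

    ∑-distrib-+ : ∀ (f g : A → ℕ) xs → ∑[ x ∈ xs ] (f x + g x) ≡ ∑ xs f + ∑ xs g
    ∑-distrib-+ f g []       = refl
    ∑-distrib-+ f g (x ∷ xs) =
      trans (cong (f x + g x +_) (∑-distrib-+ f g xs)) (interchange (f x) (g x) (∑ xs f) (∑ xs g))

    ∈⇒≤∑ : ∀ (f : A → ℕ) {x xs} → x ∈ xs → f x ≤ ∑ xs f
    ∈⇒≤∑ f (here refl)  = m≤m+n _ _
    ∈⇒≤∑ f (there x∈xs) = ≤-trans (∈⇒≤∑ f x∈xs) (m≤n+m _ _)

    ∈-≢-∈⇒+≤∑ : ∀ (f : A → ℕ) {x y xs} → x ∈ xs → y ∈ xs → x ≢ y → f x + f y ≤ ∑ xs f
    ∈-≢-∈⇒+≤∑ f (here refl)  (here refl)  x≢y = ⊥-elim (x≢y refl)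
    ∈-≢-∈⇒+≤∑ f (here refl)  (there y∈xs) _   = +-mono-≤ ≤-refl (∈⇒≤∑ f y∈xs)
    ∈-≢-∈⇒+≤∑ f {x} {y} {_ ∷ xs} (there x∈xs) (here refl) _ =
      subst (_≤ f y + ∑ xs f) (+-comm (f y) (f x)) (+-mono-≤ ≤-refl (∈⇒≤∑ f x∈xs))
    ∈-≢-∈⇒+≤∑ f (there x∈xs) (there y∈xs) x≢y = ≤-trans (∈-≢-∈⇒+≤∑ f x∈xs y∈xs x≢y) (m≤n+m _ _)

    ∑-when-≤ : ∀ {P : A → Set} (P? : ∀ x → Dec (P x)) {n} xs → Unique xs →
               (∀ {x y} → x ∈ xs → y ∈ xs → P x → P y → x ≡ y) →
               ∑[ x ∈ xs ] when (P? x) n ≤ n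
    ∑-when-≤ P? []       _              _        = z≤n
    ∑-when-≤ P? (x ∷ xs) (x∉xs ∷ uniq) atMostOne with P? x
    ... | yes Px = ≤-reflexive (trans (cong (_ +_) (∑-zero xs λ y∈xs → when-no (P? _) λ Py →
                     All.lookup x∉xs y∈xs (atMostOne (here refl) (there y∈xs) Px Py))) (+-identityʳ _))
    ... | no _   = ∑-when-≤ P? xs uniq λ x∈ y∈ → atMostOne (there x∈) (there y∈)

  ∑-comm : ∀ {A B : Set} (f : A → B → ℕ) xs ys →
           ∑[ x ∈ xs ] ∑[ y ∈ ys ] f x y ≡ ∑[ y ∈ ys ] ∑[ x ∈ xs ] f x y
  ∑-comm f []       ys = sym (∑-zero ys λ _ → refl)
  ∑-comm f (x ∷ xs) ys =
    trans (cong (∑ ys (f x) +_) (∑-comm f xs ys)) (sym (∑-distrib-+ (f x) _ ys))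

module Charging where

  open import Data.Nat using (ℕ; _+_; _*_; _∸_; _≤_; s≤s; z≤n)
  open import Data.Nat.Properties
    using (+-mono-≤; ≤-refl; ≤-trans; ≤-reflexive; ∸-monoʳ-≤; m∸n+n≡m; *-identityʳ; module ≤-Reasoning)
  open import Data.List using (List; length)
  open import Data.List.Membership.Propositional using (_∈_; _∉_)
  open import Data.List.Relation.Unary.All as All using (All)
  open import Data.List.Relation.Unary.Unique.Propositional using (Unique)
  open import Data.Product using (_×_; _,_; ∃)
  open import Data.Sum using (_⊎_; inj₁; inj₂)
  open import Function using (_∘_)
  open import Relation.Nullary using (Dec)
  open import Relation.Binary.Definitions using (DecidableEquality)
  open import Relation.Binary.PropositionalEquality using (_≡_; _≢_; refl; cong; sym; trans; subst)
  open ListSums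

  charging-bound : ∀ {A B : Set} {R : A → B → Set} → DecidableEquality A → (∀ x y → Dec (R x y)) →
    (xs zs : List A) (ys : List B) → Unique zs → Unique ys → All (_∈ xs) zs →
    (∀ {x y y′} → x ∈ xs → y ∈ ys → y′ ∈ ys → R x y → R x y′ → y ≡ y′) →
    (∀ {y} → y ∈ ys → ∃ λ x → x ∈ xs × R x y × (x ∉ zs ⊎ ∃ λ x′ → x′ ∈ xs × x′ ≢ x × R x′ y)) →
    length ys * 2 + length zs ≤ length xs * 2
  charging-bound {A} {B} {R} _≟_ R? xs zs ys uniq-zs uniq-ys zs⊆xs below-once charged = begin
    length ys * 2 + length zs                            ≡⟨ cong (_+ length zs) (∑-const ys 2) ⟨
    ∑[ y ∈ ys ] 2 + length zs                            ≤⟨ +-mono-≤ (∑-mono ys 2≤received) length-zs≤ ⟩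
    ∑[ y ∈ ys ] ∑[ x ∈ xs ] pays x y + ∑ xs multiplicity ≡⟨ cong (_+ ∑ xs multiplicity) (∑-comm pays xs ys) ⟨
    ∑[ x ∈ xs ] ∑[ y ∈ ys ] pays x y + ∑ xs multiplicity ≤⟨ +-mono-≤ (∑-mono xs paid≤price) ≤-refl ⟩
    ∑ xs price + ∑ xs multiplicity                       ≡⟨ ∑-distrib-+ price multiplicity xs ⟨
    ∑[ x ∈ xs ] (price x + multiplicity x)               ≤⟨ ∑-mono xs (λ _ → ≤-reflexive price+multiplicity≡2) ⟩
    ∑[ x ∈ xs ] 2                                        ≡⟨ ∑-const xs 2 ⟩
    length xs * 2                                        ∎
    where
    open ≤-Reasoning

    multiplicity : A → ℕ
    multiplicity x = ∑[ z ∈ zs ] when (x ≟ z) 1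

    price : A → ℕ
    price x = 2 ∸ multiplicity x

    pays : A → B → ℕ
    pays x y = when (R? x y) (price x)

    multiplicity≤1 : ∀ {x} → multiplicity x ≤ 1
    multiplicity≤1 = ∑-when-≤ (_ ≟_) zs uniq-zs λ _ _ x≡z x≡z′ → trans (sym x≡z) x≡z′

    price+multiplicity≡2 : ∀ {x} → price x + multiplicity x ≡ 2
    price+multiplicity≡2 = m∸n+n≡m (≤-trans multiplicity≤1 (s≤s z≤n))

    1≤price : ∀ {x} → 1 ≤ price x
    1≤price = ∸-monoʳ-≤ 2 multiplicity≤1

    uncovered-price : ∀ {x} → x ∉ zs → price x ≡ 2
    uncovered-price x∉zs = cong (2 ∸_) (∑-zero zs λ z∈zs → when-no (_ ≟ _) λ { refl → x∉zs z∈zs })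

    pays-price : ∀ {x y} → R x y → pays x y ≡ price x
    pays-price = when-yes (R? _ _)

    2≤received : ∀ {y} → y ∈ ys → 2 ≤ ∑[ x ∈ xs ] pays x y
    2≤received y∈ys with charged y∈ys
    ... | x , x∈xs , Rxy , inj₁ x∉zs =
      subst (_≤ _) (trans (pays-price Rxy) (uncovered-price x∉zs)) (∈⇒≤∑ (λ x → pays x _) x∈xs)
    ... | x , x∈xs , Rxy , inj₂ (x′ , x′∈xs , x′≢x , Rx′y) = ≤-trans
      (+-mono-≤ (subst (1 ≤_) (sym (pays-price Rxy)) 1≤price)
                (subst (1 ≤_) (sym (pays-price Rx′y)) 1≤price))
      (∈-≢-∈⇒+≤∑ (λ x → pays x _) x∈xs x′∈xs (λ x≡x′ → x′≢x (sym x≡x′)))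

    paid≤price : ∀ {x} → x ∈ xs → ∑[ y ∈ ys ] pays x y ≤ price x
    paid≤price x∈xs = ∑-when-≤ (R? _) ys uniq-ys (below-once x∈xs)

    occurs : ∀ {z} → z ∈ xs → 1 ≤ ∑[ x ∈ xs ] when (x ≟ z) 1
    occurs {z} z∈xs =
      subst (_≤ ∑[ x ∈ xs ] when (x ≟ z) 1) (when-yes (z ≟ z) refl) (∈⇒≤∑ (λ x → when (x ≟ z) 1) z∈xs)

    length-zs≤ : length zs ≤ ∑ xs multiplicity
    length-zs≤ = begin
      length zs                                   ≡⟨ *-identityʳ (length zs) ⟨
      length zs * 1                               ≡⟨ ∑-const zs 1 ⟨
      ∑[ z ∈ zs ] 1                               ≤⟨ ∑-mono zs (occurs ∘ All.lookup zs⊆xs) ⟩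
      ∑[ z ∈ zs ] ∑[ x ∈ xs ] when (x ≟ z) 1      ≡⟨ ∑-comm (λ x z → when (x ≟ z) 1) xs zs ⟨
      ∑ xs multiplicity                           ∎

module RationalBound where

  open import Data.Nat as ℕ using (ℕ)
  open import Data.Integer as ℤ using (+_)
  import Data.Integer.Properties as ℤ
  import Data.Nat.Coprimality as Coprime
  open import Data.Rational
  open import Data.Rational.Properties
  open import Data.Rational.Solver using (module +-*-Solver)
  open import Relation.Binary.PropositionalEquality using (_≡_; refl; sym; cong; cong₂; subst₂; trans)
  open +-*-Solver

  fromℕ : ℕ → ℚ
  fromℕ n = + n / 1

  fromℕ≡mkℚ : ∀ n → fromℕ n ≡ mkℚ (+ n) 0 (Coprime.sym (Coprime.1-coprimeTo n))
  fromℕ≡mkℚ n = normalize-coprime (Coprime.sym (Coprime.1-coprimeTo n))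

  fromℕ-mono-≤ : ∀ {a b} → a ℕ.≤ b → fromℕ a ≤ fromℕ b
  fromℕ-mono-≤ {a} {b} a≤b rewrite fromℕ≡mkℚ a | fromℕ≡mkℚ b =
    *≤* (subst₂ ℤ._≤_ (sym (ℤ.*-identityʳ (+ a))) (sym (ℤ.*-identityʳ (+ b))) (ℤ.+≤+ a≤b))

  fromℕ-+ : ∀ a b → fromℕ (a ℕ.+ b) ≡ fromℕ a + fromℕ b
  fromℕ-+ a b rewrite fromℕ≡mkℚ a | fromℕ≡mkℚ b =
    cong (_/ 1) (trans (ℤ.pos-+ a b) (sym (cong₂ ℤ._+_ (ℤ.*-identityʳ (+ a)) (ℤ.*-identityʳ (+ b)))))

  fromℕ-* : ∀ a b → fromℕ (a ℕ.* b) ≡ fromℕ a * fromℕ b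
  fromℕ-* a b rewrite fromℕ≡mkℚ a | fromℕ≡mkℚ b = cong (_/ 1) (ℤ.pos-* a b)

  2ν′+c≤2ν⇒ν′≤[1-½γ]ν : ∀ (γ : ℚ) {ν c ν′} → γ * fromℕ ν ≤ fromℕ c →
                        ν′ ℕ.* 2 ℕ.+ c ℕ.≤ ν ℕ.* 2 → fromℕ ν′ ≤ (1ℚ - ½ * γ) * fromℕ ν
  2ν′+c≤2ν⇒ν′≤[1-½γ]ν γ {ν} {c} {ν′} γν≤c 2ν′+c≤2ν = begin
    ν̂′                         ≡⟨ solve 2 (λ x y → x := con ½ :* ((x :* con two :+ y) :- y)) refl ν̂′ ĉ ⟩
    ½ * ((ν̂′ * two + ĉ) - ĉ)    ≤⟨ *-monoˡ-≤-nonNeg ½ (+-monoˡ-≤ (- ĉ) in-ℚ) ⟩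
    ½ * (ν̂ * two - ĉ)          ≤⟨ *-monoˡ-≤-nonNeg ½ (+-monoʳ-≤ (ν̂ * two) (neg-antimono-≤ γν≤c)) ⟩
    ½ * (ν̂ * two - γ * ν̂)      ≡⟨ solve 2 (λ g x → con ½ :* (x :* con two :- g :* x)
                                                := (con 1ℚ :- con ½ :* g) :* x) refl γ ν̂ ⟩
    (1ℚ - ½ * γ) * ν̂           ∎
    where
    open ≤-Reasoning
    ν̂ = fromℕ ν
    ĉ = fromℕ c
    ν̂′ = fromℕ ν′
    two = fromℕ 2
    in-ℚ : ν̂′ * two + ĉ ≤ ν̂ * two
    in-ℚ = subst₂ _≤_ (trans (fromℕ-+ (ν′ ℕ.* 2) c) (cong (_+ ĉ) (fromℕ-* ν′ 2))) (fromℕ-* ν 2)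
                      (fromℕ-mono-≤ 2ν′+c≤2ν)

open import Defs
open import Data.Nat using (ℕ)
open import Data.Fin using (Fin)
open import Data.Fin.Subset using (Subset; _∉_; _∩_; _∪_; ⊥)

module RootedConnectivity {n m : ℕ} (G : Digraph n m) (r : Fin n) (T : Subset n) (ℓ : ℕ) where

  open import Data.Nat using (_+_; _*_; _≤_; _≤?_)
  open import Data.Nat.Properties
    using (≤-trans; +-mono-≤; +-monoʳ-≤; +-cancelʳ-≤; <-irrefl; module ≤-Reasoning)
  open import Data.Bool using (true; false; _∧_; not)
  open import Data.Bool.Properties using (¬-not; not-¬)
  open import Data.Fin.Properties using (_≟_)
  open import Data.Fin.Subset using (_∈_; _⊆_)
  open import Data.Fin.Subset.Properties
    using (_∈?_; _⊆?_; nonempty?; p⊆q⇒∣p∣≤∣q∣; p⊆p∪q; p∩q⊆p; x∈p∩q⁺; x∈p∩q⁻; x∈p∪q⁺; x∈p∪q⁻; ⊆-antisym)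
  open import Data.List using (List; length)
  import Data.List.Membership.Propositional as List
  open import Data.List.Relation.Unary.All as All using (All)
  open import Data.List.Relation.Unary.Any using (here; there; any?)
  open import Data.List.Relation.Unary.Unique.Propositional using (Unique)
  open import Data.Product using (_×_; _,_; proj₁; proj₂; ∃)
  open import Data.Sum using (_⊎_; inj₁; inj₂; [_,_]′)
  open import Data.Vec using (lookup)
  open import Data.Vec.Properties using (lookup∘tabulate; []=⇒lookup; lookup⇒[]=; ≡-dec)
  import Data.Bool as Bool
  open import Function using (_∘_)
  open import Relation.Nullary using (¬_; Dec; yes; no; contradiction)
  open import Relation.Nullary.Decidable using (¬?; _×-dec_; decidable-stable)
  open import Relation.Unary using (Decidable)
  open import Relation.Binary.PropositionalEquality
    using (_≡_; _≢_; refl; sym; trans; cong; cong₂; subst)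
  open Subsets
  open Charging

  private variable
    H H′ E′ : Subset m
    U A B C C′ : Subset n
    s t : Fin n
    e : Fin m
    es : List (Fin m)

  private
    _≟ₛ_ : (A B : Subset n) → Dec (A ≡ B)
    _≟ₛ_ = ≡-dec Bool._≟_

    ∉⇒lookup≡false : ∀ {k} {x : Fin k} {p : Subset k} → x ∉ p → lookup p x ≡ false
    ∉⇒lookup≡false {x = x} {p} x∉p = ¬-not (x∉p ∘ lookup⇒[]= x p)

    ∧-not-∧≡true : ∀ a b c → a ∧ (not b ∧ c) ≡ true → a ≡ true × b ≡ false × c ≡ true
    ∧-not-∧≡true true  false true  refl = refl , refl , refl
    ∧-not-∧≡true true  false false ()
    ∧-not-∧≡true true  true  _     ()
    ∧-not-∧≡true false _     _     ()

  ∈-entering⁺ : e ∈ H → tl G e ∉ U → hd G e ∈ U → e ∈ entering G H U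
  ∈-entering⁺ {e} {H} {U} e∈H tl∉U hd∈U = lookup⇒[]= e (entering G H U) (trans (lookup∘tabulate _ e)
    (cong₂ _∧_ ([]=⇒lookup e∈H) (cong₂ (λ b c → not b ∧ c) (∉⇒lookup≡false tl∉U) ([]=⇒lookup hd∈U))))

  ∈-entering⁻ : e ∈ entering G H U → e ∈ H × tl G e ∉ U × hd G e ∈ U
  ∈-entering⁻ {e} {H} {U} e∈ with ∧-not-∧≡true _ _ _ (trans (sym (lookup∘tabulate _ e)) ([]=⇒lookup e∈))
  ... | H[e] , U[tl] , U[hd] =
    lookup⇒[]= e H H[e] , not-¬ U[tl] ∘ []=⇒lookup , lookup⇒[]= (hd G e) U U[hd]

  degIn-mono : ∀ U → H ⊆ H′ → degIn G H U ≤ degIn G H′ U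
  degIn-mono {H} U H⊆H′ = p⊆q⇒∣p∣≤∣q∣ λ e∈ →
    let e∈H , tl∉U , hd∈U = ∈-entering⁻ {H = H} {U} e∈ in ∈-entering⁺ (H⊆H′ e∈H) tl∉U hd∈U

  deficient-antimono : H ⊆ H′ → Deficient G r T ℓ H′ U → Deficient G r T ℓ H U
  deficient-antimono {U = U} H⊆H′ (r∉U , terminal , deg≤ℓ) =
    r∉U , terminal , ≤-trans (degIn-mono U H⊆H′) deg≤ℓ

  entering-∩∪⊆∩ : entering G H (A ∩ B) ∩ entering G H (A ∪ B) ⊆ entering G H A ∩ entering G H B
  entering-∩∪⊆∩ {H} {A} {B} e∈ with x∈p∩q⁻ (entering G H (A ∩ B)) _ e∈
  ... | e∈∩ , e∈∪ with ∈-entering⁻ {H = H} {A ∩ B} e∈∩ | ∈-entering⁻ {H = H} {A ∪ B} e∈∪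
  ... | e∈H , _ , hd∈A∩B | _ , tl∉A∪B , _ = x∈p∩q⁺
    ( ∈-entering⁺ e∈H (tl∉A∪B ∘ x∈p∪q⁺ ∘ inj₁) (proj₁ (x∈p∩q⁻ A B hd∈A∩B))
    , ∈-entering⁺ e∈H (tl∉A∪B ∘ x∈p∪q⁺ ∘ inj₂) (proj₂ (x∈p∩q⁻ A B hd∈A∩B)))

  entering-∩∪⊆∪ : entering G H (A ∩ B) ∪ entering G H (A ∪ B) ⊆ entering G H A ∪ entering G H B
  entering-∩∪⊆∪ {H} {A} {B} {e} e∈ with x∈p∪q⁻ (entering G H (A ∩ B)) _ e∈
  ... | inj₁ e∈∩ with ∈-entering⁻ {H = H} {A ∩ B} e∈∩ | tl G e ∈? A
  ...   | e∈H , tl∉A∩B , hd∈A∩B | yes tl∈A =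
    x∈p∪q⁺ (inj₂ (∈-entering⁺ e∈H (λ tl∈B → tl∉A∩B (x∈p∩q⁺ (tl∈A , tl∈B))) (proj₂ (x∈p∩q⁻ A B hd∈A∩B))))
  ...   | e∈H , _ , hd∈A∩B | no tl∉A = x∈p∪q⁺ (inj₁ (∈-entering⁺ e∈H tl∉A (proj₁ (x∈p∩q⁻ A B hd∈A∩B))))
  entering-∩∪⊆∪ {H} {A} {B} {e} e∈ | inj₂ e∈∪ with ∈-entering⁻ {H = H} {A ∪ B} e∈∪
  ... | e∈H , tl∉A∪B , hd∈A∪B with x∈p∪q⁻ A B hd∈A∪B
  ...   | inj₁ hd∈A = x∈p∪q⁺ (inj₁ (∈-entering⁺ e∈H (tl∉A∪B ∘ x∈p∪q⁺ ∘ inj₁) hd∈A))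
  ...   | inj₂ hd∈B = x∈p∪q⁺ (inj₂ (∈-entering⁺ e∈H (tl∉A∪B ∘ x∈p∪q⁺ ∘ inj₂) hd∈B))

  degIn-submodular : degIn G H (A ∩ B) + degIn G H (A ∪ B) ≤ degIn G H A + degIn G H B
  degIn-submodular {H} {A} {B} = ∣p∣+∣q∣≤∣r∣+∣s∣ (entering-∩∪⊆∩ {H} {A} {B}) (entering-∩∪⊆∪ {H} {A} {B})

  walk-mono : H ⊆ H′ → Walk G H s t es → Walk G H′ s t es
  walk-mono H⊆H′ nil           = nil
  walk-mono H⊆H′ (cons e∈H w)  = cons (H⊆H′ e∈H) (walk-mono H⊆H′ w)

  rootedConnected-mono : H ⊆ H′ → RootedConnected G r T ℓ H → RootedConnected G r T ℓ H′
  rootedConnected-mono H⊆H′ connected t t∈T =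
    let P , paths , disjoint = connected t t∈T
    in P , (λ i → walk-mono H⊆H′ (proj₁ (paths i)) , proj₂ (paths i)) , disjoint

  walk-enters : Walk G H s t es → s ∉ U → t ∈ U → ∃ λ e → e List.∈ es × e ∈ entering G H U
  walk-enters nil                 s∉U s∈U = contradiction s∈U s∉U
  walk-enters {U = U} (cons {e} e∈H w) tl∉U t∈U with hd G e ∈? U
  ... | yes hd∈U = e , here refl , ∈-entering⁺ e∈H tl∉U hd∈U
  ... | no  hd∉U = let e′ , e′∈es , e′∈ = walk-enters w hd∉U t∈U in e′ , there e′∈es , e′∈

  rootedConnected⇒ℓ≤degIn : RootedConnected G r T ℓ H → r ∉ U → t ∈ U → t ∈ T → ℓ ≤ degIn G H U
  rootedConnected⇒ℓ≤degIn {H} {U} {t} connected r∉U t∈U t∈T =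
    injective⇒≤∣p∣ {f = proj₁ ∘ crossing} crossing-injective (proj₂ ∘ proj₂ ∘ crossing)
    where
    P = proj₁ (connected t t∈T)
    crossing : ∀ i → ∃ λ e → e List.∈ P i × e ∈ entering G H U
    crossing i = walk-enters (proj₁ (proj₁ (proj₂ (connected t t∈T)) i)) r∉U t∈U
    crossing-injective : ∀ {i j} → proj₁ (crossing i) ≡ proj₁ (crossing j) → i ≡ j
    crossing-injective {i} {j} same with i ≟ j
    ... | yes i≡j = i≡j
    ... | no  i≢j = contradiction (subst (List._∈ P j) (sym same) (proj₁ (proj₂ (crossing j))))
                      (proj₂ (proj₂ (connected t t∈T)) i j i≢j _ (proj₁ (proj₂ (crossing i))))

  deficient? : Decidable (Deficient G r T ℓ H)
  deficient? {H} U = ¬? (r ∈? U) ×-dec nonempty? (U ∩ T) ×-dec (degIn G H U ≤? ℓ)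

  deficient⇒⊇core : Deficient G r T ℓ H U → ∃ λ C → Core G r T ℓ H C × C ⊆ U
  deficient⇒⊇core {H} = ⊆-minimal (deficient? {H})

  deficient-∩ : RootedConnected G r T ℓ H → Deficient G r T ℓ H A → Deficient G r T ℓ H B →
                t ∈ A → t ∈ B → t ∈ T → Deficient G r T ℓ H (A ∩ B)
  deficient-∩ {H} {A} {B} {t} connected (r∉A , _ , degA≤ℓ) (r∉B , _ , degB≤ℓ) t∈A t∈B t∈T =
    r∉A ∘ proj₁ ∘ x∈p∩q⁻ A B , (t , x∈p∩q⁺ (x∈p∩q⁺ (t∈A , t∈B) , t∈T)) , +-cancelʳ-≤ ℓ _ ℓ (begin
      degIn G H (A ∩ B) + ℓ                   ≤⟨ +-monoʳ-≤ (degIn G H (A ∩ B)) ℓ≤degA∪B ⟩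
      degIn G H (A ∩ B) + degIn G H (A ∪ B)   ≤⟨ degIn-submodular {H} {A} {B} ⟩
      degIn G H A + degIn G H B               ≤⟨ +-mono-≤ degA≤ℓ degB≤ℓ ⟩
      ℓ + ℓ                                   ∎)
    where
    open ≤-Reasoning
    ℓ≤degA∪B : ℓ ≤ degIn G H (A ∪ B)
    ℓ≤degA∪B = rootedConnected⇒ℓ≤degIn connected ([ r∉A , r∉B ]′ ∘ x∈p∪q⁻ A B) (x∈p∪q⁺ (inj₁ t∈A)) t∈T

  core-⊆ : RootedConnected G r T ℓ H → Core G r T ℓ H A → Core G r T ℓ H B →
           t ∈ A → t ∈ B → t ∈ T → A ⊆ B
  core-⊆ {A = A} {B} connected (defA , minA) (defB , _) t∈A t∈B t∈T {x} x∈A with x ∈? B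
  ... | yes x∈B = x∈B
  ... | no  x∉B = contradiction (deficient-∩ connected defA defB t∈A t∈B t∈T)
                    (minA (A ∩ B) (p∩q⊆p A B , x , x∈A , x∉B ∘ proj₂ ∘ x∈p∩q⁻ A B))

  cores-sharing-terminal : RootedConnected G r T ℓ H → Core G r T ℓ H A → Core G r T ℓ H B →
                           t ∈ A → t ∈ B → t ∈ T → A ≡ B
  cores-sharing-terminal connected coreA coreB t∈A t∈B t∈T =
    ⊆-antisym (core-⊆ connected coreA coreB t∈A t∈B t∈T) (core-⊆ connected coreB coreA t∈B t∈A t∈T)

  ¬InHalo-of-covered : CoversHalo G r T ℓ H E′ C → Core G r T ℓ (H ∪ E′) C′ → ¬ InHalo G r T ℓ H C C′
  ¬InHalo-of-covered covers ((_ , _ , deg≤ℓ) , _) inHalo = <-irrefl refl (≤-trans (covers _ inHalo) deg≤ℓ)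

  covered-core⇒second-core : ∀ {cores} → (∀ C₁ → Core G r T ℓ H C₁ → C₁ List.∈ cores) →
    CoversHalo G r T ℓ H E′ C → Core G r T ℓ (H ∪ E′) C′ → C ⊆ C′ →
    ∃ λ C₁ → C₁ List.∈ cores × C₁ ≢ C × C₁ ⊆ C′
  covered-core⇒second-core {H} {E′} {C} {C′} {cores} listed covers coreC′ C⊆C′
    with any? (λ C₁ → ¬? (C₁ ≟ₛ C) ×-dec (C₁ ⊆? C′)) cores
  ... | yes another = List.find another
  ... | no  none    = contradiction inHalo (¬InHalo-of-covered {H} {E′} covers coreC′)
    where
    inHalo : InHalo G r T ℓ H C C′
    inHalo = deficient-antimono {H} (p⊆p∪q E′) (proj₁ coreC′) , C⊆C′ , λ C₁ coreC₁ C₁⊆C′ →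
      decidable-stable (C₁ ≟ₛ C) λ C₁≢C → none (List.lose (listed C₁ coreC₁) (C₁≢C , C₁⊆C′))

  core-count-bound : RootedConnected G r T ℓ H →
    (cores : List (Subset n)) → Enumerates (Core G r T ℓ H) cores →
    (covered : List (Subset n)) → Unique covered →
    All (λ C → Core G r T ℓ H C × CoversHalo G r T ℓ H E′ C) covered →
    (cores′ : List (Subset n)) → Enumerates (Core G r T ℓ (H ∪ E′)) cores′ →
    length cores′ * 2 + length covered ≤ length cores * 2
  core-count-bound {H} {E′} connected cores (_ , core⇔) covered uniq covers cores′ (uniq′ , core′⇔) =
    charging-bound (≡-dec Bool._≟_) _⊆?_ cores covered cores′ uniq uniq′
      (All.map (λ (core , _) → proj₂ (core⇔ _) core) covers) below-once charged
    where
    H⊆H∪E′ : H ⊆ H ∪ E′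
    H⊆H∪E′ = p⊆p∪q E′

    below-once : C List.∈ cores → A List.∈ cores′ → B List.∈ cores′ → C ⊆ A → C ⊆ B → A ≡ B
    below-once C∈ A∈ B∈ C⊆A C⊆B with proj₁ (core⇔ _) C∈
    ... | (_ , (t , t∈C∩T) , _) , _ with x∈p∩q⁻ _ T t∈C∩T
    ... | t∈C , t∈T = cores-sharing-terminal (rootedConnected-mono H⊆H∪E′ connected)
                        (proj₁ (core′⇔ _) A∈) (proj₁ (core′⇔ _) B∈) (C⊆A t∈C) (C⊆B t∈C) t∈T

    charged : C′ List.∈ cores′ → ∃ λ C → C List.∈ cores × C ⊆ C′ ×
              (C List.∉ covered ⊎ ∃ λ C₁ → C₁ List.∈ cores × C₁ ≢ C × C₁ ⊆ C′)
    charged {C′} C′∈ with proj₁ (core′⇔ C′) C′∈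
    ... | coreC′ with deficient⇒⊇core {H} (deficient-antimono H⊆H∪E′ (proj₁ coreC′))
    ... | C , coreC , C⊆C′ with any? (C ≟ₛ_) covered
    ...   | no  C∉ = C , proj₂ (core⇔ C) coreC , C⊆C′ , inj₁ C∉
    ...   | yes C∈ = C , proj₂ (core⇔ C) coreC , C⊆C′ , inj₂ (covered-core⇒second-core {H} {E′}
                       (λ C₁ → proj₂ (core⇔ C₁)) (proj₂ (All.lookup covers C∈)) coreC′ C⊆C′)

open import Data.List using (List; length)
open import Data.List.Relation.Unary.All using (All)
open import Data.List.Relation.Unary.Unique.Propositional using (Unique)
open import Data.Product using (_×_)
open import Data.Integer using (+_)
open import Data.Rational using (ℚ; _/_; _*_; _-_; _≤_; 0ℚ; 1ℚ; ½)
open import Relation.Binary.PropositionalEquality using (_≡_)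

open RationalBound using (2ν′+c≤2ν⇒ν′≤[1-½γ]ν)
open RootedConnectivity using (core-count-bound)

lemma9 : ∀ {n m : ℕ} (G : Digraph n m) (r : Fin n) (T : Subset n) (ℓ : ℕ) →
    r ∉ T →
    (H : Subset m) → RootedConnected G r T ℓ H →
    (E' : Subset m) → E' ∩ H ≡ ⊥ →
    (γ : ℚ) → 0ℚ ≤ γ → γ ≤ 1ℚ →
    (cores : List (Subset n)) → Enumerates (Core G r T ℓ H) cores →
    (covered : List (Subset n)) → Unique covered →
    All (λ C → Core G r T ℓ H C × CoversHalo G r T ℓ H E' C) covered →
    γ * (+ length cores / 1) ≤ + length covered / 1 →
    (cores' : List (Subset n)) → Enumerates (Core G r T ℓ (H ∪ E')) cores' →
    + length cores' / 1 ≤ (1ℚ - ½ * γ) * (+ length cores / 1)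
lemma9 G r T ℓ _ H connected E′ _ γ _ _ cores enum covered uniq covers γν≤c cores′ enum′ =
  2ν′+c≤2ν⇒ν′≤[1-½γ]ν γ {length cores} {length covered} {length cores′} γν≤c
    (core-count-bound G r T ℓ {H} {E′} connected cores enum covered uniq covers cores′ enum′)
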